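{- Let $G$ and $H$ be graphs. If for every vertex $v\in V(H)$ there exists a subgraph embedding of $H$ into $G$ that is induced with respect to $v$, then $G\xrightarrow{\cap}H$.
   Context: All graphs are finite and simple. For graphs $G_1=(V_1,E_1)$, $G_2=(V_2,E_2)$, $G_1\cap G_2=(V_1\cap V_2,E_1\cap E_2)$. For $G=(V,E)$ and an injective map $\alpha$ on $V$, $G^{\alpha}$ has vertex set $\alpha(V)$ and edge set $\{\{\alpha(v),\alpha(w)\}:\{v,w\}\in E\}$. We write $G\xrightarrow{\cap}H$ if $H=G^{\alpha_1}\cap\cdots\cap G^{\alpha_k}$ for some injective maps $\alpha_1,\dots,\alpha_k$ on $V(G)$ (up to isomorphism of $H$). A subgraph embedding of $H$ into $G$ is an injective map $\varphi:V(H)\to V(G)$ such that $\varphi(u)\varphi(v)\in E(G)$ whenever $uv\in E(H)$. It is induced with respect to $v\in V(H)$ if $\varphi(N_H(v))=N_G(\varphi(v))\cap\varphi(V(H))$. -}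

module Defs where

open import Data.Nat using (ℕ; suc)
open import Data.Fin using (Fin)
open import Data.Product using (Σ; ∃; _×_; _,_)
open import Relation.Binary.PropositionalEquality using (_≡_)
open import Relation.Nullary using (¬_)
open import Function.Definitions using (Injective)
open import Function.Bundles using (_⇔_)

record Graph : Set₁ where
  field
    n     : ℕ
    E     : Fin n → Fin n → Set
    sym   : ∀ {u v} → E u v → E v u
    irrefl : ∀ {u} → ¬ E u u
open Graph public

V : Graph → Set
V G = Fin (n G)

IsSubgraphEmbedding : (H G : Graph) → (V H → V G) → Set
IsSubgraphEmbedding H G φ =
  Injective _≡_ _≡_ φ × (∀ {u v} → E H u v → E G (φ u) (φ v))

InducedAt : (H G : Graph) → (V H → V G) → V H → Set
InducedAt H G φ v =
  ∀ (w : V G) → (∃ λ u → E H v u × φ u ≡ w) ⇔ (E G (φ v) w × ∃ λ u → φ u ≡ w)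

-- Injective copies G^α live in the ambient vertex universe ℕ.
-- Vertex set of G^{α_1} ∩ ... ∩ G^{α_k}  (maps indexed by Fin k).
InterVertex : (G : Graph) (k : ℕ) → (Fin k → V G → ℕ) → ℕ → Set
InterVertex G k α x = ∀ i → ∃ λ v → α i v ≡ x

InterEdge : (G : Graph) (k : ℕ) → (Fin k → V G → ℕ) → ℕ → ℕ → Set
InterEdge G k α x y =
  ∀ i → ∃ λ v → ∃ λ w → E G v w × α i v ≡ x × α i w ≡ y

-- G →∩ H : H is isomorphic to G^{α_1} ∩ ... ∩ G^{α_k} for some k ≥ 1
-- and injective α_i : V(G) → ℕ.  The isomorphism is given by an injective
-- β : V(H) → ℕ whose image is exactly the intersection vertex set and which
-- maps adjacency in H exactly onto edges of the intersection.
IntersectionRepresents : (G H : Graph) → Set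
IntersectionRepresents G H =
  Σ ℕ λ k → Σ (Fin (suc k) → V G → ℕ) λ α →
    (∀ i → Injective _≡_ _≡_ (α i)) ×
    Σ (V H → ℕ) λ β →
      Injective _≡_ _≡_ β ×
      (∀ x → InterVertex G (suc k) α x ⇔ (∃ λ u → β u ≡ x)) ×
      (∀ u v → E H u v ⇔ InterEdge G (suc k) α (β u) (β v))

-- Given an embedding φ of H into G, relabel G so that φ(u) gets the label u and
-- every other vertex gets a label that is fresh for this copy.  H then lies in
-- every relabelled copy.  A copy induced with respect to u joins the labels u and
-- w of H only if uw ∈ E(H), so the copies induced at all vertices cut the
-- edges down to E(H); two further copies with disjoint fresh labels cut the
-- vertices down to V(H), also when H has no vertices.
module Submission where

open import Defs hiding (sym)
open import Data.Nat using (ℕ; zero; suc; _*_)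
open import Data.Fin using (Fin; toℕ; join; splitAt; combine) renaming (zero to fzero; suc to fsuc)
open import Data.Fin.Properties
  using (¬Fin0; any?; toℕ-injective; toℕ-↑ˡ; splitAt-join; combine-injectiveˡ; combine-injectiveʳ)
  renaming (_≟_ to _≟ᶠ_)
open import Data.Product using (∃; _×_; _,_; proj₂)
open import Data.Sum using (_⊎_; inj₁; inj₂)
open import Data.Sum.Properties using (inj₂-injective)
open import Data.Empty using (⊥-elim)
open import Relation.Nullary using (Dec; yes; no; contradiction)
open import Relation.Binary.PropositionalEquality
  using (_≡_; refl; sym; trans; cong; subst; subst₂; module ≡-Reasoning)
open import Function using (_∘_)
open import Function.Definitions using (Injective)
open import Function.Bundles using (_⇔_; mk⇔; Equivalence)

record Embedding (H G : Graph) : Set where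
  constructor embedding
  field
    map                 : V H → V G
    injective           : Injective _≡_ _≡_ map
    preserves-adjacency : ∀ {u v} → E H u v → E G (map u) (map v)

inducedAt-reflects-adjacency : {H G : Graph} {φ : V H → V G} {u v : V H} →
  Injective _≡_ _≡_ φ → InducedAt H G φ u → E G (φ u) (φ v) → E H u v
inducedAt-reflects-adjacency {H} {_} {φ} {u} {v} φ-inj induced φuφv
  with w , uw , φw≡φv ← Equivalence.from (induced (φ v)) (φuφv , v , refl)
  = subst (E H u) (φ-inj φw≡φv) uw

fin-inhabited? : (m : ℕ) → Dec (Fin m)
fin-inhabited? zero = no ¬Fin0
fin-inhabited? (suc m) = yes fzero

embedding-from-pointwise : {H G : Graph} → (V H → Embedding H G) → Embedding H G
embedding-from-pointwise {H} ψ with fin-inhabited? (n H)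
... | yes v = ψ v
... | no ¬v = embedding (λ v → ⊥-elim (¬v v)) (λ {v} _ → ⊥-elim (¬v v)) (λ {v} _ → ⊥-elim (¬v v))

label : {m K : ℕ} → Fin m ⊎ Fin K → ℕ
label {m} {K} = toℕ ∘ join m K

label-inj₁ : {m K : ℕ} (u : Fin m) → label {K = K} (inj₁ u) ≡ toℕ u
label-inj₁ {K = K} u = toℕ-↑ˡ u K

label-injective : {m K : ℕ} → Injective _≡_ _≡_ (label {m} {K})
label-injective {m} {K} {a} {b} eq = begin
  a                      ≡⟨ sym (splitAt-join m K a) ⟩
  splitAt m (join m K a) ≡⟨ cong (splitAt m) (toℕ-injective eq) ⟩
  splitAt m (join m K b) ≡⟨ splitAt-join m K b ⟩
  b                      ∎
  where open ≡-Reasoning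

module Relabelling {m N K : ℕ} (φ : Fin m → Fin N) (φ-inj : Injective _≡_ _≡_ φ)
                   (fresh : Fin N → Fin K) (fresh-inj : Injective _≡_ _≡_ fresh) where

  preimage? : (x : Fin N) → Dec (∃ λ u → φ u ≡ x)
  preimage? x = any? (λ u → φ u ≟ᶠ x)

  slot : Fin N → Fin m ⊎ Fin K
  slot x with preimage? x
  ... | yes (u , _) = inj₁ u
  ... | no _ = inj₂ (fresh x)

  slot-φ : ∀ u → slot (φ u) ≡ inj₁ u
  slot-φ u with preimage? (φ u)
  ... | yes (u′ , φu′≡φu) = cong inj₁ (φ-inj φu′≡φu)
  ... | no ∄u = contradiction (u , refl) ∄u

  slot≡inj₁⇒φ≡ : ∀ {x u} → slot x ≡ inj₁ u → φ u ≡ x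
  slot≡inj₁⇒φ≡ {x} eq with preimage? x
  slot≡inj₁⇒φ≡ refl | yes (_ , φu≡x) = φu≡x

  slot≡inj₂⇒fresh≡ : ∀ {x y} → slot x ≡ inj₂ y → fresh x ≡ y
  slot≡inj₂⇒fresh≡ {x} eq with preimage? x
  slot≡inj₂⇒fresh≡ refl | no _ = refl

  slot-injective : Injective _≡_ _≡_ slot
  slot-injective {x} {y} eq with preimage? x | preimage? y
  slot-injective refl | yes (_ , φu≡x) | yes (_ , φu≡y) = trans (sym φu≡x) φu≡y
  slot-injective eq | no _ | no _ = fresh-inj (inj₂-injective eq)

module _ {H G : Graph} {k : ℕ} (ψ : Fin (suc (suc k)) → Embedding H G) where

  copy : Fin (suc (suc k)) → V H → V G
  copy i = Embedding.map (ψ i)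

  private
    fresh : Fin (suc (suc k)) → V G → Fin (suc (suc k) * n G)
    fresh = combine

    module Copy (i : Fin (suc (suc k))) =
      Relabelling (copy i) (Embedding.injective (ψ i)) (fresh i) (combine-injectiveʳ i _ i _)

  relabel : Fin (suc (suc k)) → V G → ℕ
  relabel i = label ∘ Copy.slot i

  relabel-copy : ∀ i u → relabel i (copy i u) ≡ toℕ u
  relabel-copy i u = trans (cong label (Copy.slot-φ i u)) (label-inj₁ u)

  relabel-injective : ∀ i → Injective _≡_ _≡_ (relabel i)
  relabel-injective i = Copy.slot-injective i ∘ label-injective

  -- A label shared by copies 0 and 1 cannot be fresh in both: their fresh labels are disjoint.
  interVertex⇔label : ∀ x → InterVertex G (suc (suc k)) relabel x ⇔ (∃ λ u → toℕ u ≡ x)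
  interVertex⇔label x = mk⇔ to (λ (u , u≡x) i → copy i u , trans (relabel-copy i u) u≡x)
    where
    to : InterVertex G (suc (suc k)) relabel x → ∃ λ u → toℕ u ≡ x
    to inter with inter fzero | inter (fsuc fzero)
    ... | a , a↦x | b , b↦x with Copy.slot fzero a in slot-a
    ... | inj₁ u = u , trans (sym (label-inj₁ u)) a↦x
    ... | inj₂ y =
      contradiction (combine-injectiveˡ {m = suc (suc k)} fzero a (fsuc fzero) b fresh-a≡fresh-b) λ ()
      where
      slot-b : Copy.slot (fsuc fzero) b ≡ inj₂ y
      slot-b = label-injective (trans b↦x (sym a↦x))
      fresh-a≡fresh-b : fresh fzero a ≡ fresh (fsuc fzero) b
      fresh-a≡fresh-b = trans (Copy.slot≡inj₂⇒fresh≡ fzero slot-a)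
                              (sym (Copy.slot≡inj₂⇒fresh≡ (fsuc fzero) slot-b))

  relabel≡toℕ⇒copy≡ : ∀ {i a u} → relabel i a ≡ toℕ u → copy i u ≡ a
  relabel≡toℕ⇒copy≡ {i} {u = u} a↦u =
    Copy.slot≡inj₁⇒φ≡ i (label-injective (trans a↦u (sym (label-inj₁ u))))

  adjacent⇔interEdge : (∀ u → ∃ λ i → InducedAt H G (copy i) u) →
    ∀ u v → E H u v ⇔ InterEdge G (suc (suc k)) relabel (toℕ u) (toℕ v)
  adjacent⇔interEdge induced u v = mk⇔ to from
    where
    to : E H u v → InterEdge G (suc (suc k)) relabel (toℕ u) (toℕ v)
    to uv i = copy i u , copy i v , Embedding.preserves-adjacency (ψ i) uv ,
              relabel-copy i u , relabel-copy i v

    from : InterEdge G (suc (suc k)) relabel (toℕ u) (toℕ v) → E H u v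
    from inter with i , induced-at-u ← induced u with a , b , ab , a↦u , b↦v ← inter i
      = inducedAt-reflects-adjacency {H} {G} (Embedding.injective (ψ i)) induced-at-u
          (subst₂ (E G) (sym (relabel≡toℕ⇒copy≡ a↦u)) (sym (relabel≡toℕ⇒copy≡ b↦v)) ab)

  intersection-of-relabelled-copies : (∀ u → ∃ λ i → InducedAt H G (copy i) u) →
    IntersectionRepresents G H
  intersection-of-relabelled-copies induced =
    suc k , relabel , relabel-injective , toℕ , toℕ-injective ,
    interVertex⇔label , adjacent⇔interEdge induced

lemma2 : (G H : Graph) →
    (∀ (v : V H) → ∃ λ (φ : V H → V G) → IsSubgraphEmbedding H G φ × InducedAt H G φ v) →
    IntersectionRepresents G H
lemma2 G H induced-embedding =
  intersection-of-relabelled-copies ψ λ u → fsuc (fsuc u) , proj₂ (proj₂ (induced-embedding u))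
  where
  embedding-at : V H → Embedding H G
  embedding-at v with φ , (φ-inj , φ-adj) , _ ← induced-embedding v = embedding φ φ-inj φ-adj

  ψ : Fin (suc (suc (n H))) → Embedding H G
  ψ (fsuc (fsuc u)) = embedding-at u
  ψ _ = embedding-from-pointwise embedding-at
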